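{- Let $\mathsf{n}=(L_1,\dots,L_n)$ be a tuple of linear subspaces of a finite-dimensional vector space $V$ over a field $\mathbb{K}$. Every circuit $\mathsf{c}$ of the Minkowski matroid $\mathsf{M}(\mathsf{n})$ satisfies $\delta(\mathsf{c})=-1$.
   Context: A tuple is a finite indexed family of linear subspaces of $V$ (repetitions allowed); a subtuple is a subfamily indexed by a subset of the index set, and unions, intersections and complements of subtuples are taken on index sets. For a tuple $\mathsf{k}$, its linear span is $\langle\mathsf{k}\rangle=\sum_{L\in\mathsf{k}}L$ (the zero space for the empty tuple), its cardinality $\mathfrak{c}(\mathsf{k})$ is the number of its entries, and its defect is $\delta(\mathsf{k})=\dim\langle\mathsf{k}\rangle-\mathfrak{c}(\mathsf{k})$. A tuple is linearly independent if every subtuple of it (including itself) has non-negative defect. The Minkowski matroid $\mathsf{M}(\mathsf{n})$ is the matroid whose ground set is the set of entries (indices) of $\mathsf{n}$ and whose independent sets are the linearly independent subtuples of $\mathsf{n}$. A circuit is a minimal (by inclusion) linearly dependent subtuple. -}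

module Defs where

open import Level using (Level; _⊔_; suc)
open import Algebra.Bundles using (CommutativeRing)
open import Data.Nat using (ℕ; zero; _≤_) renaming (suc to sucℕ)
open import Data.Fin using (Fin)
import Data.Fin as F
open import Data.Fin.Subset using (Subset; _∈_; _⊆_; _⊂_; ∣_∣)
open import Data.Product using (Σ; ∃; _×_; _,_)
open import Relation.Nullary using (¬_)
open import Relation.Binary.PropositionalEquality using (_≡_)
open import Data.Integer using (ℤ; +_) renaming (_≤_ to _≤ℤ_) renaming (_-_ to _-ℤ_)

record Field (c ℓ : Level) : Set (suc (c ⊔ ℓ)) where
  field
    commRing : CommutativeRing c ℓ
  open CommutativeRing commRing public
  field
    1≉0     : ¬ (1# ≈ 0#)
    inverse : ∀ x → ¬ (x ≈ 0#) → Σ Carrier λ y → (x * y) ≈ 1#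

module LinearAlgebra {c ℓ : Level} (K : Field c ℓ) where
  open Field K

  Vec : ℕ → Set c
  Vec d = Fin d → Carrier

  module _ {d : ℕ} where
    _≈ᵥ_ : Vec d → Vec d → Set ℓ
    u ≈ᵥ v = ∀ j → u j ≈ v j

    0ᵥ : Vec d
    0ᵥ _ = 0#

    _+ᵥ_ : Vec d → Vec d → Vec d
    (u +ᵥ v) j = u j + v j

    _·_ : Carrier → Vec d → Vec d
    (a · v) j = a * v j

    sumᵥ : ∀ {k} → (Fin k → Vec d) → Vec d
    sumᵥ {zero}   f = 0ᵥ
    sumᵥ {sucℕ k} f = f F.zero +ᵥ sumᵥ (λ i → f (F.suc i))

  record Subspace (p : Level) (d : ℕ) : Set (c ⊔ ℓ ⊔ suc p) where
    field
      _∋_    : Vec d → Set p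
      resp   : ∀ {u v} → u ≈ᵥ v → _∋_ u → _∋_ v
      zero∈  : _∋_ 0ᵥ
      +-closed : ∀ {u v} → _∋_ u → _∋_ v → _∋_ (u +ᵥ v)
      ·-closed : ∀ a {v} → _∋_ v → _∋_ (a · v)
  open Subspace public

  LinIndep : ∀ {d k} → (Fin k → Vec d) → Set (c ⊔ ℓ)
  LinIndep {d} {k} w =
    ∀ (a : Fin k → Carrier) → sumᵥ (λ i → a i · w i) ≈ᵥ 0ᵥ → ∀ i → a i ≈ 0#

  HasIndep : ∀ {p d} → (Vec d → Set p) → ℕ → Set (c ⊔ ℓ ⊔ p)
  HasIndep {d = d} U k =
    Σ (Fin k → Vec d) λ w → (∀ i → U (w i)) × LinIndep w

  HasDim : ∀ {p d} → (Vec d → Set p) → ℕ → Set (c ⊔ ℓ ⊔ p)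
  HasDim U k = HasIndep U k × ¬ HasIndep U (sucℕ k)

  -- A tuple n = (L_1, …, L_n) of subspaces of K^d (indexed family, repetitions allowed).
  Tuple : (p : Level) (d n : ℕ) → Set (c ⊔ ℓ ⊔ suc p)
  Tuple p d n = Fin n → Subspace p d

  module _ {p d n} (L : Tuple p d n) where
    span : Subset n → Vec d → Set (c ⊔ ℓ ⊔ p)
    span S v = Σ (Fin n → Vec d) λ u →
      (∀ i → i ∈ S → L i ∋ u i) × (∀ i → ¬ (i ∈ S) → u i ≈ᵥ 0ᵥ) × (v ≈ᵥ sumᵥ u)

    -- δ(S) = dim ⟨S⟩ − 𝔠(S) (as an integer), stated relationally.
    HasDefect : Subset n → ℤ → Set (c ⊔ ℓ ⊔ p)
    HasDefect S z = Σ ℕ λ k → HasDim (span S) k × (z ≡ (+ k) -ℤ (+ ∣ S ∣))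

    LinIndepSub : Subset n → Set (c ⊔ ℓ ⊔ p)
    LinIndepSub S = ∀ S′ → S′ ⊆ S → ∀ z → HasDefect S′ z → (+ 0) ≤ℤ z

    Circuit : Subset n → Set (c ⊔ ℓ ⊔ p)
    Circuit C = ¬ LinIndepSub C × (∀ S → S ⊂ C → LinIndepSub S)

{-# OPTIONS --safe #-}
-- Let k = dim ⟨C⟩. All proper subtuples of a circuit C are independent, so if ∣ C ∣ ≤ k then C
-- itself would have non-negative defect and be independent; hence k < ∣ C ∣. Deleting one entry
-- of C leaves an independent subtuple S with ⟨S⟩ ⊆ ⟨C⟩, so ∣ C ∣ - 1 = ∣ S ∣ ≤ dim ⟨S⟩ ≤ k.
module Submission where

open import Defs
open import Level using (Level)
open import Data.Nat using (ℕ; zero; suc; _≤_; _<_; _≤′_; ≤′-refl; ≤′-step; z≤n; s≤s; _≤?_)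
open import Data.Nat.Properties
  using (≤-refl; ≤-reflexive; ≤-trans; ≤-<-trans; ≤-antisym; ≮⇒≥; ≰⇒>; ≤⇒≤′; m≤n⇒m≤1+n; n≤1+n)
open import Data.Fin using (Fin)
import Data.Fin as Fin
open import Data.Fin.Subset using (Subset; _∈_; _⊆_; _⊂_; ∣_∣; _-_; Nonempty; inside; outside)
open import Data.Fin.Subset.Properties
  using (_∈?_; _⊂?_; ⊆-refl; ⊆-antisym; p─⊥≡p; x∈p⇒p-x⊂p)
open import Data.Integer using (ℤ; +_; -[1+_]; _⊖_; +≤+)
import Data.Integer as ℤ
open import Data.Integer.Properties
  using (0≤i-j⇒j≤i; i≤j⇒0≤j-i; drop‿+≤+; [+m]-[+n]≡m⊖n; [1+m]⊖[1+n]≡m⊖n)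
open import Data.Product using (∃-syntax; _×_; _,_; proj₁; proj₂)
import Data.Product as Product
open import Data.Sum using (_⊎_; inj₁; inj₂)
open import Data.Vec using (_∷_; here; there)
open import Function using (_∘_)
open import Relation.Nullary using (¬_; yes; no)
open import Relation.Nullary.Decidable using (decidable-stable; ¬¬-excluded-middle)
open import Relation.Nullary.Negation using (¬¬-map)
open import Relation.Binary.PropositionalEquality using (_≡_; refl; sym; cong)
open import Relation.Binary.PropositionalEquality.Properties using (module ≡-Reasoning)

⊆⇒⊂⊎≡ : ∀ {n} {p q : Subset n} → p ⊆ q → p ⊂ q ⊎ p ≡ q
⊆⇒⊂⊎≡ {p = p} {q} p⊆q with p ⊂? q
... | yes p⊂q = inj₁ p⊂q
... | no  p⊄q = inj₂ (⊆-antisym p⊆q q⊆p)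
  where
  q⊆p : q ⊆ p
  q⊆p {x} x∈q = decidable-stable (x ∈? p) (λ x∉p → p⊄q (p⊆q , x , x∈q , x∉p))

∣p∣>0⇒Nonempty : ∀ {n} (p : Subset n) → 0 < ∣ p ∣ → Nonempty p
∣p∣>0⇒Nonempty (inside  ∷ p) _     = Fin.zero , here
∣p∣>0⇒Nonempty (outside ∷ p) ∣p∣>0 = Product.map Fin.suc there (∣p∣>0⇒Nonempty p ∣p∣>0)

∣p∣≤1+∣p-x∣ : ∀ {n} (p : Subset n) (x : Fin n) → ∣ p ∣ ≤ suc ∣ p - x ∣
∣p∣≤1+∣p-x∣ (inside  ∷ p) Fin.zero    = ≤-reflexive (cong (suc ∘ ∣_∣) (sym (p─⊥≡p p)))
∣p∣≤1+∣p-x∣ (outside ∷ p) Fin.zero    =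
  ≤-trans (n≤1+n ∣ p ∣) (≤-reflexive (cong (suc ∘ ∣_∣) (sym (p─⊥≡p p))))
∣p∣≤1+∣p-x∣ (inside  ∷ p) (Fin.suc x) = s≤s (∣p∣≤1+∣p-x∣ p x)
∣p∣≤1+∣p-x∣ (outside ∷ p) (Fin.suc x) = ∣p∣≤1+∣p-x∣ p x

m⊖1+m≡-1 : ∀ m → m ⊖ suc m ≡ -[1+ 0 ]
m⊖1+m≡-1 zero    = refl
m⊖1+m≡-1 (suc m) = begin
  suc m ⊖ suc (suc m) ≡⟨ [1+m]⊖[1+n]≡m⊖n m (suc m) ⟩
  m ⊖ suc m           ≡⟨ m⊖1+m≡-1 m ⟩
  -[1+ 0 ]            ∎
  where open ≡-Reasoning

¬¬-boundary : ∀ {q} (Q : ℕ → Set q) {k} → Q 0 → ¬ Q (suc k) →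
              ¬ ¬ (∃[ m ] m ≤ k × Q m × ¬ Q (suc m))
¬¬-boundary Q {zero}  q₀ ¬q₁ ¬boundary = ¬boundary (0 , z≤n , q₀ , ¬q₁)
¬¬-boundary Q {suc k} q₀ ¬q  ¬boundary = ¬¬-excluded-middle λ where
  (yes q) → ¬boundary (suc k , ≤-refl , q , ¬q)
  (no ¬q′) → ¬¬-boundary Q q₀ ¬q′ (¬boundary ∘ Product.map₂ (Product.map₁ m≤n⇒m≤1+n))

module _ {c ℓ : Level} (K : Field c ℓ) where
  open Field K using (Carrier; 0#; +-cong; +-identityˡ; zeroˡ)
    renaming (sym to ≈-sym; trans to ≈-trans)
  open LinearAlgebra K

  module _ {d : ℕ} where

    HasIndep-zero : ∀ {q} (U : Vec d → Set q) → HasIndep U 0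
    HasIndep-zero U = (λ ()) , (λ ()) , (λ _ _ ())

    HasIndep-⊆ : ∀ {q r} {U : Vec d → Set q} {W : Vec d → Set r} →
                 (∀ {v} → U v → W v) → ∀ {k} → HasIndep U k → HasIndep W k
    HasIndep-⊆ U⊆W (w , w∈U , indep) = w , (U⊆W ∘ w∈U) , indep

    HasIndep-pred : ∀ {q} (U : Vec d → Set q) {k} → HasIndep U (suc k) → HasIndep U k
    HasIndep-pred U {k} (w , w∈U , indep) = w ∘ Fin.suc , w∈U ∘ Fin.suc , indep-tail
      where
      indep-tail : LinIndep (w ∘ Fin.suc)
      indep-tail a combination≈0 i = indep a′ combination′≈0 (Fin.suc i)
        where
        a′ : Fin (suc k) → Carrier
        a′ Fin.zero    = 0#
        a′ (Fin.suc i) = a i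
        combination′≈0 : sumᵥ (λ i → a′ i · w i) ≈ᵥ 0ᵥ
        combination′≈0 j =
          ≈-trans (+-cong (zeroˡ (w Fin.zero j)) (combination≈0 j)) (+-identityˡ 0#)

    HasIndep-mono : ∀ {q} (U : Vec d → Set q) {m k} → m ≤ k → HasIndep U k → HasIndep U m
    HasIndep-mono U = go ∘ ≤⇒≤′
      where
      go : ∀ {m k} → m ≤′ k → HasIndep U k → HasIndep U m
      go ≤′-refl        h = h
      go (≤′-step m≤′k) h = go m≤′k (HasIndep-pred U h)

    HasDim-unique : ∀ {q} (U : Vec d → Set q) {k k′} → HasDim U k → HasDim U k′ → k ≡ k′
    HasDim-unique U (hk , ¬hk+1) (hk′ , ¬hk′+1) = ≤-antisym
      (≮⇒≥ λ k′<k → ¬hk′+1 (HasIndep-mono U k′<k hk))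
      (≮⇒≥ λ k<k′ → ¬hk+1 (HasIndep-mono U k<k′ hk′))

  module _ {p d n} (L : Tuple p d n) where

    span-mono : ∀ {S T} → S ⊆ T → ∀ {v} → span L S v → span L T v
    span-mono {S} {T} S⊆T (u , u∈L , u≈0 , v≈Σu) = u , u∈L′ , u≈0′ , v≈Σu
      where
      u∈L′ : ∀ i → i ∈ T → L i ∋ u i
      u∈L′ i i∈T with i ∈? S
      ... | yes i∈S = u∈L i i∈S
      ... | no  i∉S = resp (L i) (λ j → ≈-sym (u≈0 i i∉S j)) (zero∈ (L i))
      u≈0′ : ∀ i → ¬ (i ∈ T) → u i ≈ᵥ 0ᵥ
      u≈0′ i i∉T = u≈0 i (i∉T ∘ S⊆T)

    LinIndepSub⇒∣∣≤dim : ∀ {S k} → LinIndepSub L S → HasDim (span L S) k → ∣ S ∣ ≤ k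
    LinIndepSub⇒∣∣≤dim indep dim = drop‿+≤+ (0≤i-j⇒j≤i (indep _ ⊆-refl _ (_ , dim , refl)))

    -- The dimension of ⟨S⟩ need not be computable, but ∣ S ∣ ≤ k is decidable, so it suffices
    -- to bound ∣ S ∣ by a dimension that exists up to double negation.
    LinIndepSub⇒∣∣≤dim-⊇ : ∀ {S T k} → LinIndepSub L S → S ⊆ T → HasDim (span L T) k →
                           ∣ S ∣ ≤ k
    LinIndepSub⇒∣∣≤dim-⊇ {S} {k = k} indep S⊆T (_ , ¬hk+1) =
      decidable-stable (∣ S ∣ ≤? k) (¬¬-map ∣S∣≤k
        (¬¬-boundary (HasIndep (span L S)) (HasIndep-zero (span L S))
          (¬hk+1 ∘ HasIndep-⊆ {U = span L S} (span-mono S⊆T))))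
      where
      ∣S∣≤k : ∃[ m ] m ≤ k × HasIndep (span L S) m × ¬ HasIndep (span L S) (suc m) → ∣ S ∣ ≤ k
      ∣S∣≤k (_ , m≤k , dimS) = ≤-trans (LinIndepSub⇒∣∣≤dim indep dimS) m≤k

    LinIndepSub-fromProper : ∀ {C k} → (∀ S → S ⊂ C → LinIndepSub L S) →
                             HasDim (span L C) k → ∣ C ∣ ≤ k → LinIndepSub L C
    LinIndepSub-fromProper {C} proper dimC ∣C∣≤k S S⊆C z δS≡z with ⊆⇒⊂⊎≡ S⊆C
    ... | inj₁ S⊂C = proper S S⊂C S ⊆-refl z δS≡z
    ... | inj₂ refl with δS≡z
    ...   | k′ , dimC′ , refl rewrite HasDim-unique (span L C) dimC′ dimC = i≤j⇒0≤j-i (+≤+ ∣C∣≤k)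

    circuit-dim<∣∣ : ∀ {C k} → Circuit L C → HasDim (span L C) k → k < ∣ C ∣
    circuit-dim<∣∣ (dependent , proper) dimC =
      ≰⇒> (dependent ∘ LinIndepSub-fromProper proper dimC)

    circuit-∣∣≤1+dim : ∀ {C k x} → Circuit L C → x ∈ C → HasDim (span L C) k →
                       ∣ C ∣ ≤ suc k
    circuit-∣∣≤1+dim {C} {x = x} (_ , proper) x∈C dimC = ≤-trans (∣p∣≤1+∣p-x∣ C x)
      (s≤s (LinIndepSub⇒∣∣≤dim-⊇ (proper (C - x) C-x⊂C) (proj₁ C-x⊂C) dimC))
      where
      C-x⊂C : C - x ⊂ C
      C-x⊂C = x∈p⇒p-x⊂p x∈C

    circuit-∣∣≡1+dim : ∀ {C k} → Circuit L C → HasDim (span L C) k → ∣ C ∣ ≡ suc k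
    circuit-∣∣≡1+dim {C} {k} circuit dimC = ≤-antisym
      (circuit-∣∣≤1+dim circuit (proj₂ (∣p∣>0⇒Nonempty C (≤-<-trans z≤n k<∣C∣))) dimC)
      k<∣C∣
      where
      k<∣C∣ : k < ∣ C ∣
      k<∣C∣ = circuit-dim<∣∣ circuit dimC

theorem1p17 : ∀ {c ℓ p : Level} (K : Field c ℓ) (d n : ℕ)
    (L : LinearAlgebra.Tuple K p d n) (C : Subset n) →
    LinearAlgebra.Circuit K L C →
    ∀ (z : ℤ) → LinearAlgebra.HasDefect K L C z → z ≡ -[1+ 0 ]
theorem1p17 K d n L C circuit _ (k , dimC , refl) = begin
  + k ℤ.- + ∣ C ∣ ≡⟨ cong (λ m → + k ℤ.- + m) (circuit-∣∣≡1+dim K L circuit dimC) ⟩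
  + k ℤ.- + suc k ≡⟨ [+m]-[+n]≡m⊖n k (suc k) ⟩
  k ⊖ suc k       ≡⟨ m⊖1+m≡-1 k ⟩
  -[1+ 0 ]        ∎
  where open ≡-Reasoning
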